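{- Let $n\ge4$. The maximum length of a coherent lattice path of size $n$ is $\ell_{\max}=\left\lfloor\tfrac32(n-1)\right\rfloor$. The number of coherent lattice paths of size $n$ and length $\ell_{\max}$ is $1$ if $n$ is odd and $\left\lfloor\tfrac32(n-1)\right\rfloor$ if $n$ is even.
   Context: A diagonal-avoiding lattice path of size $n$ (dimension 2) is a sequence of points $\boldsymbol\ell_1,\dots,\boldsymbol\ell_r\in[n]^2$ with $\boldsymbol\ell_1=(2,1)$, $\boldsymbol\ell_r\in\{(n-1,n),(n,n-1)\}$, the two coordinates of each point distinct, and consecutive points differing in exactly one coordinate, which strictly increases; its length is $r$ (the number of points). Its $i$-th enhanced step is $(a\to b;z)$ where the changing coordinate goes from $a$ to $b$ and the fixed coordinate equals $z$; $\prec$ denotes the order of steps along the path. It is a coherent lattice path if for all enhanced steps $(i\to j;a)\prec(x\to y;z)$ with $x<j$ one has $j=z$ or $x=a$. (These correspond bijectively, preserving length = number of vertices, to coherent monotone paths on the hypersimplex $\Delta(n,2)$ for a generic direction.) -}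

module Defs where

open import Data.Nat using (ℕ; _≤_; _<_; _∸_; _*_; _/_)
open import Data.Nat.Properties using (_≟_)
open import Data.Product using (_×_; _,_; proj₁; proj₂; ∃)
open import Data.Sum using (_⊎_)
open import Data.List using (List; []; _∷_; _∷ʳ_)
open import Data.List.Relation.Unary.All using (All)
open import Data.List.Relation.Unary.Linked using (Linked)
open import Data.List.Relation.Unary.AllPairs using (AllPairs)
open import Relation.Binary.PropositionalEquality using (_≡_; _≢_)
open import Relation.Nullary using (yes; no)

Point : Set
Point = ℕ × ℕ

InGrid : ℕ → Point → Set
InGrid n (x , y) = (1 ≤ x × x ≤ n) × (1 ≤ y × y ≤ n) × x ≢ y

Step : Point → Point → Set
Step (x , y) (x' , y') = (x < x' × y ≡ y') ⊎ (x ≡ x' × y < y')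

record EnhancedStep : Set where
  constructor ⟨_⇒_⨾_⟩
  field
    from  : ℕ
    to    : ℕ
    fixed : ℕ

-- Enhanced step between two consecutive points (meaningful when Step p q holds).
enhanced : Point → Point → EnhancedStep
enhanced (x , y) (x' , y') with y ≟ y'
... | yes _ = ⟨ x ⇒ x' ⨾ y ⟩
... | no  _ = ⟨ y ⇒ y' ⨾ x ⟩

enhancedSteps : List Point → List EnhancedStep
enhancedSteps []             = []
enhancedSteps (p ∷ [])       = []
enhancedSteps (p ∷ q ∷ rest) = enhanced p q ∷ enhancedSteps (q ∷ rest)

record LatticePath (n : ℕ) (ps : List Point) : Set where
  field
    starts  : ∃ λ rest → ps ≡ (2 , 1) ∷ rest
    ends    : ∃ λ init → (ps ≡ init ∷ʳ (n ∸ 1 , n)) ⊎ (ps ≡ init ∷ʳ (n , n ∸ 1))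
    inGrid  : All (InGrid n) ps
    steps   : Linked Step ps

CoherentPair : EnhancedStep → EnhancedStep → Set
CoherentPair ⟨ i ⇒ j ⨾ a ⟩ ⟨ x ⇒ y ⨾ z ⟩ = x < j → (j ≡ z ⊎ x ≡ a)

record CoherentPath (n : ℕ) (ps : List Point) : Set where
  field
    isPath   : LatticePath n ps
    coherent : AllPairs CoherentPair (enhancedSteps ps)

ℓmax : ℕ → ℕ
ℓmax n = (3 * (n ∸ 1)) / 2

{-# OPTIONS --safe #-}
module Submission where

-- Write a point as point o x v, with smaller coordinate x, larger coordinate v, and o recording
-- which coordinate is the larger one. A path moves by slides (x grows, staying below v), jumps
-- (x grows past v, so the two coordinates swap roles) and raises (v grows). Coherence turns out to
-- be equivalent to two local rules on these moves: no raise after a slide until the next jump, and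
-- after a raise of v from w the path may not stop and its next slide must reach w (see Run).
--
-- Along such a run, twice the number of points still to come plus the potential v + 2x + 1
-- (v + 2x + 2 after a slide, v + 2w after a raise from w) never exceeds 3n, because every move
-- raises the potential by 2 plus an explicit non-negative excess. Starting from (2 , 1) this gives
-- the bound ⌊3(n - 1)/2⌋. A path of that length has total excess 0 when n is odd, which forces a
-- unique path, and 1 when n is even; the places where that single unit can be spent enumerate the
-- ⌊3(n - 1)/2⌋ maximal paths.

open import Defs
open import Data.Bool using (Bool; true; false; not)
open import Data.Empty using (⊥; ⊥-elim)
open import Data.Unit using (⊤; tt)
open import Data.Maybe using (just)
open import Data.Nat using (ℕ; zero; suc; _+_; _*_; _∸_; _/_; _%_; _≤_; _<_; z≤n; s≤s; _≤?_)
open import Data.Nat.Properties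
  using ( _≟_; <-cmp; ≤-refl; ≤-reflexive; ≤-trans; <-trans; <-irrefl; <-asym; ≤-pred; <⇒≤; <⇒≢
        ; <⇒≱; ≰⇒>; n≤1+n; n<1+n; m≤m+n; m∸n≤m; m+n≤o⇒m≤o; m+n≤o⇒n≤o; m≤n⇒∃[o]m+o≡n
        ; +-monoʳ-≤; +-cancelˡ-≤; +-identityʳ; +-suc; +-assoc; *-suc; suc-injective; 1+n≢n
        ; 0≢1+n; m≢1+m+n; m≢1+n+m; m+1+n≢m; module ≤-Reasoning )
open import Data.Nat.DivMod using (m*n/n≡m; /-monoˡ-≤; +-distrib-/; m*n%n≡0; [m+kn]%n≡m%n)
open import Data.Nat.Tactic.RingSolver using (solve-∀)
open import Data.Product using (_×_; _,_; proj₁; proj₂; ∃; Σ)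
open import Data.Sum using (_⊎_; inj₁; inj₂)
open import Data.List using (List; []; _∷_; length; last; _∷ʳ_; map)
open import Data.List.Properties using (length-map; ∷-injectiveˡ; ∷-injectiveʳ)
open import Data.List.Membership.Propositional using (_∈_)
open import Data.List.Membership.Propositional.Properties using (∈-map⁺; ∈-map⁻)
open import Data.List.Relation.Unary.Any using (here; there)
open import Data.List.Relation.Unary.All as All using (All; []; _∷_)
import Data.List.Relation.Unary.All.Properties as All
open import Data.List.Relation.Unary.AllPairs using (AllPairs; []; _∷_)
open import Data.List.Relation.Unary.Linked using (Linked; []; [-]; _∷_)
open import Data.List.Relation.Unary.Unique.Propositional using (Unique)
import Data.List.Relation.Unary.Unique.Propositional.Properties as Unique
open import Function using (_∘_)
open import Function.Bundles using (_⇔_; mk⇔; Equivalence)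
open import Relation.Binary.Definitions using (tri<; tri≈; tri>)
open import Relation.Binary.PropositionalEquality
  using (_≡_; _≢_; refl; sym; trans; cong; cong₂; subst; subst₂; ≢-sym; module ≡-Reasoning)
open import Relation.Nullary using (yes; no)

private variable
  n x x' v w b i j a : ℕ
  o : Bool
  p : Point
  ps rest : List Point

-- Moves and runs

point : Bool → ℕ → ℕ → Point
point true  x v = v , x
point false x v = x , v

data Phase : Set where
  free sliding : Phase
  raised : ℕ → Phase

private variable
  φ : Phase

SlideAllowed : Phase → ℕ → Set
SlideAllowed (raised w) x' = w ≤ x'
SlideAllowed _          _  = ⊤

RaiseAllowed : Phase → Set
RaiseAllowed sliding = ⊥
RaiseAllowed _       = ⊤

EndAllowed : Phase → Set
EndAllowed (raised _) = ⊥
EndAllowed _          = ⊤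

-- Run n φ o x v rest: point o x v ∷ rest is the tail of a coherent path of size n, and φ records
-- the move into point o x v: free after a jump (or at the start), sliding after a slide, raised w
-- after a raise from (x , w).
data Run : ℕ → Phase → Bool → ℕ → ℕ → List Point → Set where
  end   : EndAllowed φ → Run (suc x) φ o x (suc x) []
  slide : x < x' → x' < v → SlideAllowed φ x' → Run n sliding o x' v rest →
          Run n φ o x v (point o x' v ∷ rest)
  jump  : v < b → b ≤ n → Run n free (not o) v b rest →
          Run n φ o x v (point (not o) v b ∷ rest)
  raise : v < b → b ≤ n → RaiseAllowed φ → Run n (raised v) o x b rest →
          Run n φ o x v (point o x b ∷ rest)

enhanced-horizontal : ∀ x x' y → enhanced (x , y) (x' , y) ≡ ⟨ x ⇒ x' ⨾ y ⟩
enhanced-horizontal x x' y with y ≟ y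
... | yes _  = refl
... | no y≢y = ⊥-elim (y≢y refl)

enhanced-vertical : ∀ x y y' → y ≢ y' → enhanced (x , y) (x , y') ≡ ⟨ y ⇒ y' ⨾ x ⟩
enhanced-vertical x y y' y≢y' with y ≟ y'
... | yes y≡y' = ⊥-elim (y≢y' y≡y')
... | no _     = refl

enhanced-slide : ∀ o → x ≢ x' → enhanced (point o x v) (point o x' v) ≡ ⟨ x ⇒ x' ⨾ v ⟩
enhanced-slide true  = enhanced-vertical _ _ _
enhanced-slide false = λ _ → enhanced-horizontal _ _ _

enhanced-jump : ∀ o → x ≢ b → enhanced (point o x v) (point (not o) v b) ≡ ⟨ x ⇒ b ⨾ v ⟩
enhanced-jump true  = enhanced-vertical _ _ _
enhanced-jump false = λ _ → enhanced-horizontal _ _ _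

enhanced-raise : ∀ o → v ≢ b → enhanced (point o x v) (point o x b) ≡ ⟨ v ⇒ b ⨾ x ⟩
enhanced-raise true  = λ _ → enhanced-horizontal _ _ _
enhanced-raise false = enhanced-vertical _ _ _

data Move (o : Bool) (x v : ℕ) : Point → EnhancedStep → Set where
  slide : x < x' → x' < v → Move o x v (point o x' v) ⟨ x ⇒ x' ⨾ v ⟩
  jump  : v < b → Move o x v (point (not o) v b) ⟨ x ⇒ b ⨾ v ⟩
  raise : v < b → Move o x v (point o x b) ⟨ v ⇒ b ⨾ x ⟩

OffDiagonal : Point → Set
OffDiagonal (x , y) = x ≢ y

step⇒move : ∀ o → OffDiagonal p → Step (point o x v) p →
            ∃ λ e → Move o x v p e × enhanced (point o x v) p ≡ e
step⇒move {p = b , _} true _ (inj₁ (v<b , refl)) = _ , raise v<b , enhanced-horizontal _ b _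
step⇒move {p = _ , y} true b≢y (inj₂ (refl , x<y)) with <-cmp y _
... | tri< y<v _ _ = _ , slide x<y y<v , enhanced-vertical _ _ y (<⇒≢ x<y)
... | tri≈ _ y≡v _ = ⊥-elim (b≢y (sym y≡v))
... | tri> _ _ v<y = _ , jump v<y , enhanced-vertical _ _ y (<⇒≢ x<y)
step⇒move {p = y , _} {v = v} false y≢v (inj₁ (x<y , refl)) with <-cmp y v
... | tri< y<v _ _ = _ , slide x<y y<v , enhanced-horizontal _ y v
... | tri≈ _ y≡v _ = ⊥-elim (y≢v y≡v)
... | tri> _ _ v<y = _ , jump v<y , enhanced-horizontal _ y v
step⇒move {p = _ , b} false _ (inj₂ (refl , v<b)) =
  _ , raise v<b , enhanced-vertical _ _ b (<⇒≢ v<b)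

EndsAt : ℕ → List Point → Set
EndsAt n ps = last ps ≡ just (n ∸ 1 , n) ⊎ last ps ≡ just (n , n ∸ 1)

LatticeTail : ℕ → List Point → Set
LatticeTail n ps = All (InGrid n) ps × Linked Step ps × EndsAt n ps

singleton-end : ∀ o → x < v → EndsAt n (point o x v ∷ []) → n ≡ suc x × v ≡ suc x
singleton-end true  x<v (inj₁ refl) = ⊥-elim (<⇒≱ x<v (m∸n≤m _ 1))
singleton-end {n = zero}  true  x<v (inj₂ refl) = ⊥-elim (<-irrefl refl x<v)
singleton-end {n = suc _} true  x<v (inj₂ refl) = refl , refl
singleton-end {n = zero}  false x<v (inj₁ refl) = ⊥-elim (<-irrefl refl x<v)
singleton-end {n = suc _} false x<v (inj₁ refl) = refl , refl
singleton-end false x<v (inj₂ refl) = ⊥-elim (<⇒≱ x<v (m∸n≤m _ 1))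

-- Coherent paths are runs

leaving-strip-incoherent : ∀ {y} → CoherentPair ⟨ i ⇒ j ⨾ a ⟩ ⟨ x ⇒ y ⨾ v ⟩ →
                           a < x → x < j → j < v → ⊥
leaving-strip-incoherent c a<x x<j j<v with c x<j
... | inj₁ refl = <-irrefl refl j<v
... | inj₂ refl = <-irrefl refl a<x

-- Raises keep x < j < v, every other move leaves that strip from x, and no path ends inside it.
straddle-incoherent : ∀ o → LatticeTail n (point o x v ∷ rest) →
  All (CoherentPair ⟨ i ⇒ j ⨾ a ⟩) (enhancedSteps (point o x v ∷ rest)) →
  x < v → a < x → x < j → j < v → ⊥
straddle-incoherent {rest = []} o (_ , _ , e) _ x<v _ x<j j<v with singleton-end o x<v e
... | _ , refl = <⇒≱ x<j (≤-pred j<v)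
straddle-incoherent {rest = _ ∷ _} {i} {j} {a} o (_ ∷ g ∷ gs , st ∷ lk , e) (c ∷ cs) x<v a<x x<j j<v
  with step⇒move o (proj₂ (proj₂ g)) st
... | _ , slide {x'} _ _ , eq =
  leaving-strip-incoherent {i = i} {y = x'} (subst (CoherentPair ⟨ i ⇒ j ⨾ a ⟩) eq c) a<x x<j j<v
... | _ , jump {b} _ , eq =
  leaving-strip-incoherent {i = i} {y = b} (subst (CoherentPair ⟨ i ⇒ j ⨾ a ⟩) eq c) a<x x<j j<v
... | _ , raise v<b , _ =
  straddle-incoherent {i = i} o (g ∷ gs , lk , e) cs (<-trans x<v v<b) a<x x<j (<-trans j<v v<b)

private variable
  e : EnhancedStep
  es : List EnhancedStep

Arrival : ℕ → ℕ → List EnhancedStep → Set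
Arrival x v later = (x ≡ 1 × v ≡ 2) ⊎ ∃ λ i → All (CoherentPair ⟨ i ⇒ v ⨾ x ⟩) later

-- The earlier steps, coherent with all later ones, that enforce the rules of the current phase.
History : Phase → ℕ → ℕ → List EnhancedStep → Set
History free       x v later = Arrival x v later
History sliding    x v later = ∃ λ i → ∃ λ m → m < x × All (CoherentPair ⟨ i ⇒ v ⨾ m ⟩) later
History (raised w) x v later = Arrival x v later × x < w × w < v ×
                               (w ≤ suc x ⊎ ∃ λ i → All (CoherentPair ⟨ i ⇒ w ⨾ x ⟩) later)

arrival-after-slide : x < x' → x' < v → Arrival x v (e ∷ es) → History sliding x' v es
arrival-after-slide x<x' x'<v (inj₁ (refl , refl))   = ⊥-elim (<⇒≱ x<x' (≤-pred x'<v))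
arrival-after-slide x<x' x'<v (inj₂ (i , _ ∷ later)) = i , _ , x<x' , later

history-after-slide : ∀ φ → x < x' → x' < v → History φ x v (e ∷ es) → History sliding x' v es
history-after-slide free       x<x' x'<v h                         = arrival-after-slide x<x' x'<v h
history-after-slide sliding    x<x' x'<v (i , m , m<x , _ ∷ later) = i , m , <-trans m<x x<x' , later
history-after-slide (raised _) x<x' x'<v (h , _)                   = arrival-after-slide x<x' x'<v h

previous-arrival : Arrival x v (e ∷ es) → v ≤ suc x ⊎ ∃ λ i → All (CoherentPair ⟨ i ⇒ v ⨾ x ⟩) es
previous-arrival (inj₁ (refl , refl))   = inj₁ ≤-refl
previous-arrival (inj₂ (i , _ ∷ later)) = inj₂ (i , later)

history-after-raise : ∀ φ → RaiseAllowed φ → All (CoherentPair ⟨ v ⇒ b ⨾ x ⟩) es → x < v → v < b →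
                      History φ x v (e ∷ es) → History (raised v) x b es
history-after-raise {v = v} free       _ c x<v v<b h       = inj₂ (v , c) , x<v , v<b , previous-arrival h
history-after-raise {v = v} (raised _) _ c x<v v<b (h , _) = inj₂ (v , c) , x<v , v<b , previous-arrival h

slide-allowed : ∀ φ o → LatticeTail n (point o x' v ∷ rest) → x < x' → x' < v →
                History φ x v (e ∷ enhancedSteps (point o x' v ∷ rest)) → SlideAllowed φ x'
slide-allowed free    _ _ _ _ _ = tt
slide-allowed sliding _ _ _ _ _ = tt
slide-allowed {x' = x'} (raised w) o t x<x' x'<v (_ , _ , w<v , earlier) with w ≤? x'
... | yes w≤x' = w≤x'
... | no  w≰x' with earlier
...   | inj₁ w≤1+x           = ⊥-elim (w≰x' (≤-trans w≤1+x x<x'))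
...   | inj₂ (i , _ ∷ later) = ⊥-elim (straddle-incoherent {i = i} o t later x'<v x<x' (≰⇒> w≰x') w<v)

raise-allowed : ∀ φ o → LatticeTail n (point o x b ∷ rest) → x < v → v < b →
                History φ x v (e ∷ enhancedSteps (point o x b ∷ rest)) → RaiseAllowed φ
raise-allowed free       _ _ _ _ _ = tt
raise-allowed (raised _) _ _ _ _ _ = tt
raise-allowed sliding o t x<v v<b (i , m , m<x , _ ∷ later) =
  straddle-incoherent {i = i} o t later (<-trans x<v v<b) m<x x<v v<b

end-allowed : ∀ φ → History φ x (suc x) es → EndAllowed φ
end-allowed free       _                     = tt
end-allowed sliding    _                     = tt
end-allowed (raised _) (_ , x<w , w<1+x , _) = <⇒≱ x<w (≤-pred w<1+x)

larger-≤ : ∀ o → InGrid n (point o x v) → v ≤ n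
larger-≤ true  ((_ , v≤n) , _)     = v≤n
larger-≤ false (_ , (_ , v≤n) , _) = v≤n

tail⇒run : ∀ φ o → LatticeTail n (point o x v ∷ rest) →
           AllPairs CoherentPair (enhancedSteps (point o x v ∷ rest)) → x < v →
           History φ x v (enhancedSteps (point o x v ∷ rest)) → Run n φ o x v rest
tail⇒run {rest = []} φ o (_ , _ , e) _ x<v h with singleton-end o x<v e
... | refl , refl = end (end-allowed φ h)
tail⇒run {x = x} {rest = _ ∷ _} φ o (_ ∷ g ∷ gs , st ∷ lk , e) (c ∷ cs) x<v h
  with t ← (g ∷ gs , lk , e) | step⇒move o (proj₂ (proj₂ g)) st
... | _ , slide x<x' x'<v , _ =
  slide x<x' x'<v (slide-allowed φ o t x<x' x'<v h)
        (tail⇒run sliding o t cs x'<v (history-after-slide φ x<x' x'<v h))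
... | _ , jump v<b , eq =
  jump v<b (larger-≤ (not o) g)
       (tail⇒run free (not o) t cs v<b (inj₂ (x , subst (λ s → All (CoherentPair s) _) eq c)))
... | _ , raise v<b , eq =
  raise v<b (larger-≤ o g) allowed
        (tail⇒run (raised _) o t cs (<-trans x<v v<b)
           (history-after-raise φ allowed (subst (λ s → All (CoherentPair s) _) eq c) x<v v<b h))
  where allowed : RaiseAllowed φ
        allowed = raise-allowed φ o t x<v v<b h

-- Runs are coherent paths

runSteps : Run n φ o x v rest → List EnhancedStep
runSteps (end _) = []
runSteps {x = x} {v = v} (slide {x' = x'} _ _ _ r) = ⟨ x ⇒ x' ⨾ v ⟩ ∷ runSteps r
runSteps {x = x} {v = v} (jump {b = b} _ _ r)      = ⟨ x ⇒ b ⨾ v ⟩ ∷ runSteps r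
runSteps {x = x} {v = v} (raise {b = b} _ _ _ r)   = ⟨ v ⇒ b ⨾ x ⟩ ∷ runSteps r

enhancedSteps-run : (r : Run n φ o x v rest) → x < v → enhancedSteps (point o x v ∷ rest) ≡ runSteps r
enhancedSteps-run (end _) _ = refl
enhancedSteps-run {o = o} (slide x<x' x'<v _ r) _ =
  cong₂ _∷_ (enhanced-slide o (<⇒≢ x<x')) (enhancedSteps-run r x'<v)
enhancedSteps-run {o = o} (jump v<b _ r) x<v =
  cong₂ _∷_ (enhanced-jump o (<⇒≢ (<-trans x<v v<b))) (enhancedSteps-run r v<b)
enhancedSteps-run {o = o} (raise v<b _ _ r) x<v =
  cong₂ _∷_ (enhanced-raise o (<⇒≢ v<b)) (enhancedSteps-run r (<-trans x<v v<b))

steps-start-above : ∀ {y} (r : Run n φ o x v rest) → x < v → y ≤ x →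
                    All (λ s → y ≤ EnhancedStep.from s) (runSteps r)
steps-start-above (end _) _ _ = []
steps-start-above (slide x<x' x'<v _ r) _ y≤x =
  y≤x ∷ steps-start-above r x'<v (≤-trans y≤x (<⇒≤ x<x'))
steps-start-above (jump v<b _ r) x<v y≤x =
  y≤x ∷ steps-start-above r v<b (≤-trans y≤x (<⇒≤ x<v))
steps-start-above (raise v<b _ _ r) x<v y≤x =
  ≤-trans y≤x (<⇒≤ x<v) ∷ steps-start-above r (<-trans x<v v<b) y≤x

coherent-with-later : ∀ s {ts} → All (λ t → EnhancedStep.to s ≤ EnhancedStep.from t) ts →
                      All (CoherentPair s) ts
coherent-with-later s = All.map λ to≤from from<to → ⊥-elim (<⇒≱ from<to to≤from)

-- The positions (x , v) in phase φ from which every later step is coherent with an earlier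
-- step ⟨ _ ⇒ j ⨾ m ⟩.
data Safe (m j : ℕ) : Phase → ℕ → ℕ → Set where
  arrived       : Safe m j φ m j
  sliding-under : Safe m j sliding x j
  raised-over   : j < v → j ≤ w → Safe m j (raised w) m v
  passed        : j ≤ x → Safe m j φ x v

safe-coherent : ∀ i {m} (r : Run n φ o x v rest) → x < v → Safe m j φ x v →
                All (CoherentPair ⟨ i ⇒ j ⨾ m ⟩) (runSteps r)
safe-coherent {j = j} i {m} r x<v (passed j≤x) =
  coherent-with-later ⟨ i ⇒ j ⨾ m ⟩ (steps-start-above r x<v j≤x)
safe-coherent i (end _) _ _ = []
safe-coherent i (slide _ x'<v _ r) _ arrived =
  (λ _ → inj₁ refl) ∷ safe-coherent i r x'<v sliding-under
safe-coherent i (jump v<b _ r) _ arrived =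
  (λ _ → inj₁ refl) ∷ safe-coherent i r v<b (passed ≤-refl)
safe-coherent i (raise v<b _ _ r) x<v arrived =
  (λ j<j → ⊥-elim (<-irrefl refl j<j)) ∷ safe-coherent i r (<-trans x<v v<b) (raised-over v<b ≤-refl)
safe-coherent i (slide _ x'<v _ r) _ sliding-under =
  (λ _ → inj₁ refl) ∷ safe-coherent i r x'<v sliding-under
safe-coherent i (jump v<b _ r) _ sliding-under =
  (λ _ → inj₁ refl) ∷ safe-coherent i r v<b (passed ≤-refl)
safe-coherent i (raise _ _ () _) _ sliding-under
safe-coherent i (slide _ x'<v w≤x' r) _ (raised-over _ j≤w) =
  (λ _ → inj₂ refl) ∷ safe-coherent i r x'<v (passed (≤-trans j≤w w≤x'))
safe-coherent i (jump v<b _ r) _ (raised-over j<v _) =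
  (λ _ → inj₂ refl) ∷ safe-coherent i r v<b (passed (<⇒≤ j<v))
safe-coherent i (raise v<b _ _ r) x<v (raised-over j<v _) =
  (λ v<j → ⊥-elim (<-asym v<j j<v))
  ∷ safe-coherent i r (<-trans x<v v<b) (raised-over (<-trans j<v v<b) (<⇒≤ j<v))

run-coherent : (r : Run n φ o x v rest) → x < v → AllPairs CoherentPair (runSteps r)
run-coherent (end _) _ = []
run-coherent {x = x} {v = v} (slide {x' = x'} x<x' x'<v _ r) _ =
  coherent-with-later ⟨ x ⇒ x' ⨾ v ⟩ (steps-start-above r x'<v ≤-refl) ∷ run-coherent r x'<v
run-coherent {x = x} (jump v<b _ r) _ = safe-coherent x r v<b arrived ∷ run-coherent r v<b
run-coherent {v = v} (raise v<b _ _ r) x<v =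
  safe-coherent v r (<-trans x<v v<b) arrived ∷ run-coherent r (<-trans x<v v<b)

point-inGrid : ∀ o → 1 ≤ x → x < v → v ≤ n → InGrid n (point o x v)
point-inGrid true  1≤x x<v v≤n =
  (≤-trans 1≤x (<⇒≤ x<v) , v≤n) , (1≤x , ≤-trans (<⇒≤ x<v) v≤n) , ≢-sym (<⇒≢ x<v)
point-inGrid false 1≤x x<v v≤n =
  (1≤x , ≤-trans (<⇒≤ x<v) v≤n) , (≤-trans 1≤x (<⇒≤ x<v) , v≤n) , <⇒≢ x<v

step-slide : ∀ o → x < x' → Step (point o x v) (point o x' v)
step-slide true  x<x' = inj₂ (refl , x<x')
step-slide false x<x' = inj₁ (x<x' , refl)

step-jump : ∀ o → x < b → Step (point o x v) (point (not o) v b)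
step-jump true  x<b = inj₂ (refl , x<b)
step-jump false x<b = inj₁ (x<b , refl)

step-raise : ∀ o → v < b → Step (point o x v) (point o x b)
step-raise true  v<b = inj₁ (v<b , refl)
step-raise false v<b = inj₂ (refl , v<b)

final-point-ends : ∀ o → EndsAt (suc x) (point o x (suc x) ∷ [])
final-point-ends true  = inj₂ refl
final-point-ends false = inj₁ refl

run-lattice : (r : Run n φ o x v rest) → 1 ≤ x → x < v → v ≤ n → LatticeTail n (point o x v ∷ rest)
run-lattice {o = o} (end _) 1≤x x<v v≤n = point-inGrid o 1≤x x<v v≤n ∷ [] , [-] , final-point-ends o
run-lattice {o = o} (slide x<x' x'<v _ r) 1≤x x<v v≤n
  with gs , ls , e ← run-lattice r (≤-trans 1≤x (<⇒≤ x<x')) x'<v v≤n =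
  point-inGrid o 1≤x x<v v≤n ∷ gs , step-slide o x<x' ∷ ls , e
run-lattice {o = o} (jump v<b b≤n r) 1≤x x<v v≤n
  with gs , ls , e ← run-lattice r (≤-trans 1≤x (<⇒≤ x<v)) v<b b≤n =
  point-inGrid o 1≤x x<v v≤n ∷ gs , step-jump o (<-trans x<v v<b) ∷ ls , e
run-lattice {o = o} (raise v<b b≤n _ r) 1≤x x<v v≤n
  with gs , ls , e ← run-lattice r 1≤x (<-trans x<v v<b) b≤n =
  point-inGrid o 1≤x x<v v≤n ∷ gs , step-raise o v<b ∷ ls , e

-- The potential

potential : Phase → ℕ → ℕ → ℕ
potential free       x v = v + 2 * x + 1
potential sliding    x v = v + 2 * x + 2
potential (raised w) _ v = v + 2 * w

data Offset (x : ℕ) : ℕ → Set where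
  offset : ∀ d → Offset x (d + x)

offset? : ∀ {y} → x ≤ y → Offset x y
offset? {y = y} z≤n = subst (Offset 0) (+-identityʳ y) (offset y)
offset? (s≤s x≤y) with offset? x≤y
... | offset d = subst (Offset _) (+-suc d _) (offset d)

-- Each move raises the potential by 2 plus an excess, expressed through the offsets of the move
-- (x' = d + suc x, v = g + suc x or g + suc w, b = d + suc v). Arithmetic facts are kept opaque:
-- unfolding their ring-solver proofs inside the with-functions that use them is very slow.
opaque
  potential-end-free : ∀ x → potential free x (suc x) + 1 ≡ 3 * suc x
  potential-end-free = arith
    where arith : ∀ x → suc x + 2 * x + 1 + 1 ≡ 3 * suc x
          arith = solve-∀

  potential-end-sliding : ∀ x → potential sliding x (suc x) ≡ 3 * suc x
  potential-end-sliding = arith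
    where arith : ∀ x → suc x + 2 * x + 2 ≡ 3 * suc x
          arith = solve-∀

  potential-slide-free : ∀ x d v → potential sliding (d + suc x) v ≡ potential free x v + 2 + suc (d * 2)
  potential-slide-free = arith
    where arith : ∀ x d v → v + 2 * (d + suc x) + 2 ≡ v + 2 * x + 1 + 2 + suc (d * 2)
          arith = solve-∀

  potential-slide-sliding : ∀ x d v → potential sliding (d + suc x) v ≡ potential sliding x v + 2 + d * 2
  potential-slide-sliding = arith
    where arith : ∀ x d v → v + 2 * (d + suc x) + 2 ≡ v + 2 * x + 2 + 2 + d * 2
          arith = solve-∀

  potential-slide-raised : ∀ w x d v → potential sliding (d + w) v ≡ potential (raised w) x v + 2 + d * 2
  potential-slide-raised w _ = arith w
    where arith : ∀ w d v → v + 2 * (d + w) + 2 ≡ v + 2 * w + 2 + d * 2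
          arith = solve-∀

  potential-jump-free : ∀ x g d → potential free (g + suc x) (d + suc (g + suc x))
                                  ≡ potential free x (g + suc x) + 2 + suc (g * 2 + d)
  potential-jump-free = arith
    where arith : ∀ x g d → d + suc (g + suc x) + 2 * (g + suc x) + 1
                            ≡ g + suc x + 2 * x + 1 + 2 + suc (g * 2 + d)
          arith = solve-∀

  potential-jump-sliding : ∀ x g d → potential free (g + suc x) (d + suc (g + suc x))
                                     ≡ potential sliding x (g + suc x) + 2 + (g * 2 + d)
  potential-jump-sliding = arith
    where arith : ∀ x g d → d + suc (g + suc x) + 2 * (g + suc x) + 1
                            ≡ g + suc x + 2 * x + 2 + 2 + (g * 2 + d)
          arith = solve-∀

  potential-jump-raised : ∀ w x g d → potential free (g + suc w) (d + suc (g + suc w))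
                                      ≡ potential (raised w) x (g + suc w) + 2 + (2 + g * 2 + d)
  potential-jump-raised w _ = arith w
    where arith : ∀ w g d → d + suc (g + suc w) + 2 * (g + suc w) + 1
                              ≡ g + suc w + 2 * w + 2 + (2 + g * 2 + d)
          arith = solve-∀

  potential-raise-free : ∀ x g d → potential (raised (g + suc x)) x (d + suc (g + suc x))
                                   ≡ potential free x (g + suc x) + 2 + (g * 2 + d)
  potential-raise-free = arith
    where arith : ∀ x g d → d + suc (g + suc x) + 2 * (g + suc x)
                            ≡ g + suc x + 2 * x + 1 + 2 + (g * 2 + d)
          arith = solve-∀

  potential-raise-raised : ∀ w x g d → potential (raised (g + suc w)) x (d + suc (g + suc w))
                                       ≡ potential (raised w) x (g + suc w) + 2 + suc (g * 2 + d)
  potential-raise-raised w _ = arith w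
    where arith : ∀ w g d → d + suc (g + suc w) + 2 * (g + suc w)
                              ≡ g + suc w + 2 * w + 2 + suc (g * 2 + d)
          arith = solve-∀

opaque
  potential-step-arith : ∀ L c e → 2 * L + (c + 2 + e) ≡ 2 * suc L + c + e
  potential-step-arith = solve-∀

  climb : ∀ L {c c' e N} → c' ≡ c + 2 + e → 2 * L + c' ≤ N → 2 * suc L + c ≤ N
  climb L {c} {e = e} refl le =
    ≤-trans (m≤m+n (2 * suc L + c) e) (≤-trans (≤-reflexive (sym (potential-step-arith L c e))) le)

RaisedBelow : Phase → ℕ → Set
RaisedBelow (raised w) v = w < v
RaisedBelow _          _ = ⊤

potential-bound : (r : Run n φ o x v rest) → x < v → RaisedBelow φ v →
                  2 * length rest + potential φ x v ≤ 3 * n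
potential-bound {φ = free}    {x = x} (end _) _ _ = m+n≤o⇒m≤o _ (≤-reflexive (potential-end-free x))
potential-bound {φ = sliding} {x = x} (end _) _ _ = ≤-reflexive (potential-end-sliding x)
potential-bound {φ = free} {x = x} {v} (slide {rest = rs} x<x' x'<v _ r) _ _ with offset? x<x'
... | offset d = climb (length rs) (potential-slide-free x d v) (potential-bound r x'<v tt)
potential-bound {φ = sliding} {x = x} {v} (slide {rest = rs} x<x' x'<v _ r) _ _ with offset? x<x'
... | offset d = climb (length rs) (potential-slide-sliding x d v) (potential-bound r x'<v tt)
potential-bound {φ = raised w} {x = x} {v} (slide {rest = rs} _ x'<v w≤x' r) _ _ with offset? w≤x'
... | offset d = climb (length rs) (potential-slide-raised w x d v) (potential-bound r x'<v tt)
potential-bound {φ = free} {x = x} (jump {rest = rs} v<b _ r) x<v _ with offset? x<v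
... | offset g with offset? v<b
...   | offset d = climb (length rs) (potential-jump-free x g d) (potential-bound r v<b tt)
potential-bound {φ = sliding} {x = x} (jump {rest = rs} v<b _ r) x<v _ with offset? x<v
... | offset g with offset? v<b
...   | offset d = climb (length rs) (potential-jump-sliding x g d) (potential-bound r v<b tt)
potential-bound {φ = raised w} {x = x} (jump {rest = rs} v<b _ r) _ w<v with offset? w<v
... | offset g with offset? v<b
...   | offset d = climb (length rs) (potential-jump-raised w x g d) (potential-bound r v<b tt)
potential-bound {φ = free} {x = x} (raise {rest = rs} v<b _ _ r) x<v _ with offset? x<v
... | offset g with offset? v<b
...   | offset d =
  climb (length rs) (potential-raise-free x g d) (potential-bound r (<-trans x<v v<b) v<b)
potential-bound {φ = raised w} {x = x} (raise {rest = rs} v<b _ _ r) x<v w<v with offset? w<v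
... | offset g with offset? v<b
...   | offset d =
  climb (length rs) (potential-raise-raised w x g d) (potential-bound r (<-trans x<v v<b) v<b)

-- Runs of maximal length

Slack : ℕ → Phase → ℕ → ℕ → List Point → ℕ → Set
Slack n φ x v rest s = 2 * length rest + potential φ x v + s ≡ 3 * n

TightRun : ℕ → ℕ → Phase → Bool → ℕ → ℕ → List Point → Set
TightRun n s φ o x v rest = Run n φ o x v rest × Slack n φ x v rest s

opaque
  excess≤slack : ∀ L {c c' e s N} → c' ≡ c + 2 + e → 2 * suc L + c + s ≡ N → 2 * L + c' ≤ N → e ≤ s
  excess≤slack L {c} {e = e} {s} refl refl le =
    +-cancelˡ-≤ (2 * suc L + c) e s (subst (_≤ 2 * suc L + c + s) (potential-step-arith L c e) le)

  split-slack : ∀ L {c c' e s N} → c' ≡ c + 2 + e → 2 * suc L + c + s ≡ N → 2 * L + c' ≤ N →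
                ∃ λ s' → e + s' ≡ s × 2 * L + c' + s' ≡ N
  split-slack L {c} {e = e} refl refl le with s' , refl ← m≤n⇒∃[o]m+o≡n (excess≤slack L refl refl le) =
    s' , refl , (begin
      2 * L + (c + 2 + e) + s'  ≡⟨ cong (_+ s') (potential-step-arith L c e) ⟩
      2 * suc L + c + e + s'    ≡⟨ +-assoc (2 * suc L + c) e s' ⟩
      2 * suc L + c + (e + s')  ∎)
    where open ≡-Reasoning

  +-2*suc : ∀ m k → m + 2 * suc k ≡ 2 + m + 2 * k
  +-2*suc = solve-∀

descend : ∀ {c e s} (r : Run n φ o x v rest) → x < v → RaisedBelow φ v → potential φ x v ≡ c + 2 + e →
          2 * suc (length rest) + c + s ≡ 3 * n → ∃ λ s' → e + s' ≡ s × Slack n φ x v rest s'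
descend {rest = rest} r x<v below eq sl = split-slack (length rest) eq sl (potential-bound r x<v below)

beyond-end : ∀ {m b} → m < b → b ≤ n → n ≡ m + 2 * 0 → ⊥
beyond-end {m = m} m<b b≤n refl = <⇒≱ m<b (≤-trans b≤n (≤-reflexive (+-identityʳ m)))

tail₀-free tail₀-sliding : Bool → ℕ → ℕ → List Point
tail₀-free o x k = point o x (2 + x) ∷ point o (suc x) (2 + x) ∷ tail₀-sliding o (suc x) k
tail₀-sliding o y zero    = []
tail₀-sliding o y (suc k) = point (not o) (suc y) (2 + y) ∷ tail₀-free (not o) (suc y) k

slack₀-raised : TightRun n 0 (raised w) o x v rest → w < v → x < v →
                ∃ λ rest' → rest ≡ point o w v ∷ rest' × TightRun n 0 sliding o w v rest'
slack₀-raised {w = w} {x = x} {v = v} (slide {rest = rs} _ x'<v w≤x' r , sl) _ _ with offset? w≤x'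
... | offset zero with _ , refl , sl' ← descend r x'<v tt (potential-slide-raised w x 0 v) sl =
  rs , refl , r , sl'
... | offset (suc d) with _ , () , _ ← descend r x'<v tt (potential-slide-raised w x (suc d) v) sl
slack₀-raised {w = w} {x = x} (jump v<b _ r , sl) w<v _ with offset? w<v
... | offset g with offset? v<b
...   | offset d with _ , () , _ ← descend r v<b tt (potential-jump-raised w x g d) sl
slack₀-raised {w = w} {x = x} (raise v<b _ _ r , sl) w<v x<v with offset? w<v
... | offset g with offset? v<b
...   | offset d with _ , () , _ ← descend r (<-trans x<v v<b) v<b (potential-raise-raised w x g d) sl

slack₀-sliding : ∀ {y} k → TightRun n 0 sliding o y (suc y) rest → n ≡ suc y + 2 * k →
                 rest ≡ tail₀-sliding o y k
slack₀-free : ∀ k → TightRun n 0 free o x (suc x) rest → n ≡ 2 + x + 2 * k → rest ≡ tail₀-free o x k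
slack₀-sliding zero    (end _ , _) _ = refl
slack₀-sliding (suc k) (end _ , _) e = ⊥-elim (m+1+n≢m _ (sym e))
slack₀-sliding k (slide y<x' x'<1+y _ _ , _) _ = ⊥-elim (<⇒≱ y<x' (≤-pred x'<1+y))
slack₀-sliding {y = y} k (jump v<b b≤n r , sl) e with offset? v<b
... | offset (suc d) with _ , () , _ ← descend r v<b tt (potential-jump-sliding y 0 (suc d)) sl
... | offset zero with _ , refl , sl' ← descend r v<b tt (potential-jump-sliding y 0 0) sl | k
...   | zero  = ⊥-elim (beyond-end v<b b≤n e)
...   | suc k = cong (_ ∷_) (slack₀-free k (r , sl') (trans e (+-2*suc (suc y) k)))
slack₀-sliding k (raise _ _ () _ , _) _
slack₀-free {x = x} k (end _ , _) e = ⊥-elim (m≢1+m+n (suc x) e)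
slack₀-free k (slide x<x' x'<1+x _ _ , _) _ = ⊥-elim (<⇒≱ x<x' (≤-pred x'<1+x))
slack₀-free {x = x} k (jump v<b _ r , sl) _ with offset? v<b
... | offset d with _ , () , _ ← descend r v<b tt (potential-jump-free x 0 d) sl
slack₀-free {x = x} k (raise v<b _ _ r , sl) e with x<b ← <-trans (n<1+n x) v<b | offset? v<b
... | offset (suc d) with _ , () , _ ← descend r x<b v<b (potential-raise-free x 0 (suc d)) sl
... | offset zero with _ , refl , sl' ← descend r x<b v<b (potential-raise-free x 0 0) sl
  with _ , refl , t ← slack₀-raised (r , sl') (n<1+n (suc x)) x<b =
  cong (λ tail → _ ∷ _ ∷ tail) (slack₀-sliding k t e)

slack₀-sliding-wide : ∀ {y} → TightRun n 0 sliding o y (2 + y) rest →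
  ∃ λ rest' → rest ≡ point o (suc y) (2 + y) ∷ rest' × TightRun n 0 sliding o (suc y) (2 + y) rest'
slack₀-sliding-wide {y = y} (slide {rest = rs} y<x' x'<v _ r , sl) with offset? y<x'
... | offset zero with _ , refl , sl' ← descend r x'<v tt (potential-slide-sliding y 0 (2 + y)) sl =
  rs , refl , r , sl'
... | offset (suc d) with _ , () , _ ← descend r x'<v tt (potential-slide-sliding y (suc d) (2 + y)) sl
slack₀-sliding-wide {y = y} (jump v<b _ r , sl) with offset? v<b
... | offset d with _ , () , _ ← descend r v<b tt (potential-jump-sliding y 1 d) sl
slack₀-sliding-wide (raise _ _ () _ , _)

slack₀-free-wide-impossible : TightRun n 0 free o x v rest → suc x < v → ⊥
slack₀-free-wide-impossible (end _ , _) 1+x<1+x = <-irrefl refl 1+x<1+x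
slack₀-free-wide-impossible {x = x} {v = v} (slide x<x' x'<v _ r , sl) _ with offset? x<x'
... | offset d with _ , () , _ ← descend r x'<v tt (potential-slide-free x d v) sl
slack₀-free-wide-impossible {x = x} (jump v<b _ r , sl) 1+x<v with offset? (<-trans (n<1+n x) 1+x<v)
... | offset g with offset? v<b
...   | offset d with _ , () , _ ← descend r v<b tt (potential-jump-free x g d) sl
slack₀-free-wide-impossible {x = x} (raise v<b _ _ r , sl) 1+x<v
  with x<v ← <-trans (n<1+n x) 1+x<v | offset? (<-trans (n<1+n x) 1+x<v)
... | offset zero = <-irrefl refl 1+x<v
... | offset (suc g) with offset? v<b
...   | offset d with _ , () , _ ← descend r (<-trans x<v v<b) v<b (potential-raise-free x (suc g) d) sl

-- The unit of slack is spent by ending in a free state, a jump out of a free state, a raise by two,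
-- or two raises in a row.
tails₁-free tails₁-raised tails₁-sliding : Bool → ℕ → ℕ → List (List Point)
tails₁-free o x zero    = [] ∷ []
tails₁-free o x (suc k) =
  (point (not o) (suc x) (2 + x) ∷ tail₀-free (not o) (suc x) k) ∷
  (point o x (3 + x) ∷ point o (suc x) (3 + x) ∷ point o (2 + x) (3 + x) ∷ tail₀-sliding o (2 + x) k) ∷
  map (point o x (2 + x) ∷_) (tails₁-raised o x k)
tails₁-raised o x k =
  (point o x (3 + x) ∷ point o (2 + x) (3 + x) ∷ tail₀-sliding o (2 + x) k) ∷
  map (point o (suc x) (2 + x) ∷_) (tails₁-sliding o (suc x) k)
tails₁-sliding o y k = map (point (not o) (suc y) (2 + y) ∷_) (tails₁-free (not o) (suc y) k)

slack₁-free : ∀ k → TightRun n 1 free o x (suc x) rest → n ≡ suc x + 2 * k → rest ∈ tails₁-free o x k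
slack₁-raised : ∀ k → TightRun n 1 (raised (suc x)) o x (2 + x) rest → n ≡ 3 + x + 2 * k →
                rest ∈ tails₁-raised o x k
slack₁-sliding : ∀ {y} k → TightRun n 1 sliding o y (suc y) rest → n ≡ 2 + y + 2 * k →
                 rest ∈ tails₁-sliding o y k

slack₁-free zero    (end _ , _) _ = here refl
slack₁-free (suc k) (end _ , _) e = ⊥-elim (m+1+n≢m _ (sym e))
slack₁-free k (slide x<x' x'<1+x _ _ , _) _ = ⊥-elim (<⇒≱ x<x' (≤-pred x'<1+x))
slack₁-free {x = x} k (jump v<b b≤n r , sl) e with offset? v<b
... | offset (suc d) with _ , () , _ ← descend r v<b tt (potential-jump-free x 0 (suc d)) sl
... | offset zero with _ , refl , sl' ← descend r v<b tt (potential-jump-free x 0 0) sl | k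
...   | zero  = ⊥-elim (beyond-end v<b b≤n e)
...   | suc k = here (cong (_ ∷_) (slack₀-free k (r , sl') (trans e (+-2*suc (suc x) k))))
slack₁-free {x = x} k (raise v<b b≤n _ r , sl) e with <-trans (n<1+n x) v<b | offset? v<b
... | x<b | offset (suc (suc d))
  with _ , () , _ ← descend r x<b v<b (potential-raise-free x 0 (suc (suc d))) sl
... | x<b | offset zero with _ , refl , sl' ← descend r x<b v<b (potential-raise-free x 0 0) sl | k
...   | zero  = ⊥-elim (beyond-end v<b b≤n e)
...   | suc k = there (there (∈-map⁺ _ (slack₁-raised k (r , sl') (trans e (+-2*suc (suc x) k)))))
slack₁-free {x = x} k (raise v<b b≤n _ r , sl) e | x<b | offset (suc zero)
  with _ , refl , sl' ← descend r x<b v<b (potential-raise-free x 0 1) sl | k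
... | zero  = ⊥-elim (beyond-end v<b b≤n e)
... | suc k with _ , refl , t ← slack₀-raised (r , sl') v<b x<b
  with _ , refl , t' ← slack₀-sliding-wide t =
  there (here (cong (λ tail → _ ∷ _ ∷ _ ∷ tail) (slack₀-sliding k t' (trans e (+-2*suc (suc x) k)))))

slack₁-raised {x = x} k (slide _ x'<v w≤x' r , sl) e with offset? w≤x'
... | offset zero
  with _ , refl , sl' ← descend r x'<v tt (potential-slide-raised (suc x) x 0 (2 + x)) sl =
  there (∈-map⁺ _ (slack₁-sliding k (r , sl') e))
... | offset (suc d)
  with _ , () , _ ← descend r x'<v tt (potential-slide-raised (suc x) x (suc d) (2 + x)) sl
slack₁-raised {x = x} k (jump v<b _ r , sl) _ with offset? v<b
... | offset d with _ , () , _ ← descend r v<b tt (potential-jump-raised (suc x) x 0 d) sl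
slack₁-raised {x = x} k (raise v<b _ _ r , sl) e with x<b ← <-trans (s≤s (n≤1+n x)) v<b | offset? v<b
... | offset (suc d) with _ , () , _ ← descend r x<b v<b (potential-raise-raised (suc x) x 0 (suc d)) sl
... | offset zero with _ , refl , sl' ← descend r x<b v<b (potential-raise-raised (suc x) x 0 0) sl
  with _ , refl , t ← slack₀-raised (r , sl') v<b x<b =
  here (cong (λ tail → _ ∷ _ ∷ tail) (slack₀-sliding k t e))

slack₁-sliding {y = y} k (end _ , sl) _ = ⊥-elim (m+1+n≢m _ (trans sl (sym (potential-end-sliding y))))
slack₁-sliding k (slide y<x' x'<1+y _ _ , _) _ = ⊥-elim (<⇒≱ y<x' (≤-pred x'<1+y))
slack₁-sliding {y = y} k (jump v<b _ r , sl) e with offset? v<b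
... | offset zero with _ , refl , sl' ← descend r v<b tt (potential-jump-sliding y 0 0) sl =
  ∈-map⁺ _ (slack₁-free k (r , sl') e)
... | offset (suc zero) with _ , refl , sl' ← descend r v<b tt (potential-jump-sliding y 0 1) sl =
  ⊥-elim (slack₀-free-wide-impossible (r , sl') (n<1+n _))
... | offset (suc (suc d))
  with _ , () , _ ← descend r v<b tt (potential-jump-sliding y 0 (suc (suc d))) sl
slack₁-sliding k (raise _ _ () _ , _) _

n≡m+j⇒m≤n : ∀ m {j} → n ≡ m + j → m ≤ n
n≡m+j⇒m≤n m {j} refl = m≤m+n m j

run-end : n ≡ suc x + 2 * 0 → EndAllowed φ → Run n φ o x (suc x) []
run-end {x = x} {φ = φ} {o = o} refl allowed =
  subst (λ m → Run m φ o x (suc x) []) (sym (+-identityʳ (suc x))) (end allowed)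

tail₀-sliding-run : ∀ o y k → n ≡ suc y + 2 * k → Run n sliding o y (suc y) (tail₀-sliding o y k)
tail₀-free-run : ∀ o x k → n ≡ 2 + x + 2 * k → Run n free o x (suc x) (tail₀-free o x k)
tail₀-sliding-run o y zero    e = run-end e tt
tail₀-sliding-run o y (suc k) e with e' ← trans e (+-2*suc (suc y) k) =
  jump ≤-refl (<⇒≤ (n≡m+j⇒m≤n (3 + y) e')) (tail₀-free-run (not o) (suc y) k e')
tail₀-free-run o x k e =
  raise ≤-refl (n≡m+j⇒m≤n (2 + x) e) tt (slide ≤-refl ≤-refl ≤-refl (tail₀-sliding-run o (suc x) k e))

tails₁-free-run : ∀ o x k → rest ∈ tails₁-free o x k → n ≡ suc x + 2 * k → Run n free o x (suc x) rest
tails₁-raised-run : ∀ o x k → rest ∈ tails₁-raised o x k → n ≡ 3 + x + 2 * k →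
                    Run n (raised (suc x)) o x (2 + x) rest
tails₁-sliding-run : ∀ o y k → rest ∈ tails₁-sliding o y k → n ≡ 2 + y + 2 * k →
                     Run n sliding o y (suc y) rest
tails₁-free-run o x zero (here refl) e = run-end e tt
tails₁-free-run o x (suc k) (here refl) e with e' ← trans e (+-2*suc (suc x) k) =
  jump ≤-refl (<⇒≤ (n≡m+j⇒m≤n (3 + x) e')) (tail₀-free-run (not o) (suc x) k e')
tails₁-free-run o x (suc k) (there (here refl)) e with e' ← trans e (+-2*suc (suc x) k) =
  raise (s≤s (n≤1+n _)) (n≡m+j⇒m≤n (3 + x) e') tt
    (slide ≤-refl (s≤s (n≤1+n _)) ≤-refl (slide ≤-refl ≤-refl tt (tail₀-sliding-run o (2 + x) k e')))
tails₁-free-run o x (suc k) (there (there m)) e with e' ← trans e (+-2*suc (suc x) k)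
  with _ , m' , refl ← ∈-map⁻ _ m =
  raise ≤-refl (<⇒≤ (n≡m+j⇒m≤n (3 + x) e')) tt (tails₁-raised-run o x k m' e')
tails₁-raised-run o x k (here refl) e =
  raise ≤-refl (n≡m+j⇒m≤n (3 + x) e) tt
    (slide (s≤s (n≤1+n _)) ≤-refl ≤-refl (tail₀-sliding-run o (2 + x) k e))
tails₁-raised-run o x k (there m) e with _ , m' , refl ← ∈-map⁻ _ m =
  slide ≤-refl ≤-refl ≤-refl (tails₁-sliding-run o (suc x) k m' e)
tails₁-sliding-run o y k m e with _ , m' , refl ← ∈-map⁻ _ m =
  jump ≤-refl (n≡m+j⇒m≤n (2 + y) e) (tails₁-free-run (not o) (suc y) k m' e)

tail₀-sliding-length : ∀ o y k → length (tail₀-sliding o y k) ≡ 3 * k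
tail₀-free-length : ∀ o x k → length (tail₀-free o x k) ≡ 2 + 3 * k
tail₀-sliding-length o y zero    = refl
tail₀-sliding-length o y (suc k) =
  trans (cong suc (tail₀-free-length (not o) (suc y) k)) (sym (*-suc 3 k))
tail₀-free-length o x k = cong (2 +_) (tail₀-sliding-length o (suc x) k)

tails₁-free-length : ∀ o x k → rest ∈ tails₁-free o x k → length rest ≡ 3 * k
tails₁-raised-length : ∀ o x k → rest ∈ tails₁-raised o x k → length rest ≡ 2 + 3 * k
tails₁-sliding-length : ∀ o y k → rest ∈ tails₁-sliding o y k → length rest ≡ 1 + 3 * k
tails₁-free-length o x zero (here refl) = refl
tails₁-free-length o x (suc k) (here refl) =
  trans (cong suc (tail₀-free-length (not o) (suc x) k)) (sym (*-suc 3 k))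
tails₁-free-length o x (suc k) (there (here refl)) =
  trans (cong (3 +_) (tail₀-sliding-length o (2 + x) k)) (sym (*-suc 3 k))
tails₁-free-length o x (suc k) (there (there m)) with _ , m' , refl ← ∈-map⁻ _ m =
  trans (cong suc (tails₁-raised-length o x k m')) (sym (*-suc 3 k))
tails₁-raised-length o x k (here refl) = cong (2 +_) (tail₀-sliding-length o (2 + x) k)
tails₁-raised-length o x k (there m) with _ , m' , refl ← ∈-map⁻ _ m =
  cong suc (tails₁-sliding-length o (suc x) k m')
tails₁-sliding-length o y k m with _ , m' , refl ← ∈-map⁻ _ m =
  cong suc (tails₁-free-length (not o) (suc y) k m')

tails₁-free-count : ∀ o x k → length (tails₁-free o x k) ≡ 1 + 3 * k
tails₁-raised-count : ∀ o x k → length (tails₁-raised o x k) ≡ 2 + 3 * k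
tails₁-free-count o x zero    = refl
tails₁-free-count o x (suc k) =
  trans (cong (2 +_) (trans (length-map _ (tails₁-raised o x k)) (tails₁-raised-count o x k)))
        (cong suc (sym (*-suc 3 k)))
tails₁-raised-count o x k = cong suc (begin
  length (map _ (tails₁-sliding o (suc x) k))  ≡⟨ length-map _ (tails₁-sliding o (suc x) k) ⟩
  length (tails₁-sliding o (suc x) k)          ≡⟨ length-map _ (tails₁-free (not o) (2 + x) k) ⟩
  length (tails₁-free (not o) (2 + x) k)       ≡⟨ tails₁-free-count (not o) (2 + x) k ⟩
  1 + 3 * k                                    ∎)
  where open ≡-Reasoning

point-injective : ∀ o {x' v'} → point o x v ≡ point o x' v' → x ≡ x' × v ≡ v'
point-injective true  refl = refl , refl
point-injective false refl = refl , refl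

point-flip : ∀ o {x' v'} → point (not o) x v ≡ point o x' v' → v ≡ x'
point-flip true  refl = refl
point-flip false refl = refl

heads-differ : ∀ {q : Point} (L : List (List Point)) → p ≢ q → All (p ∷ ps ≢_) (map (q ∷_) L)
heads-differ L p≢q = All.map⁺ (All.universal (λ _ eq → p≢q (∷-injectiveˡ eq)) L)

tails₁-free-unique : ∀ o x k → Unique (tails₁-free o x k)
tails₁-raised-unique : ∀ o x k → Unique (tails₁-raised o x k)
tails₁-free-unique o x zero    = [] ∷ []
tails₁-free-unique o x (suc k) =
  ((2+x≢x ∘ point-flip o ∘ ∷-injectiveˡ) ∷ heads-differ (tails₁-raised o x k) (2+x≢x ∘ point-flip o))
  ∷ heads-differ (tails₁-raised o x k) (1+n≢n ∘ proj₂ ∘ point-injective o)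
  ∷ Unique.map⁺ ∷-injectiveʳ (tails₁-raised-unique o x k)
  where 2+x≢x : 2 + x ≢ x
        2+x≢x = m≢1+n+m x ∘ sym
tails₁-raised-unique o x k =
  heads-differ (tails₁-sliding o (suc x) k) (1+n≢n ∘ sym ∘ proj₁ ∘ point-injective o)
  ∷ Unique.map⁺ ∷-injectiveʳ (Unique.map⁺ ∷-injectiveʳ (tails₁-free-unique (not o) (2 + x) k))

-- Maximal coherent paths

last-∷ʳ : ∀ {A : Set} (xs : List A) y → last (xs ∷ʳ y) ≡ just y
last-∷ʳ []           y = refl
last-∷ʳ (_ ∷ [])     y = refl
last-∷ʳ (_ ∷ x ∷ xs) y = last-∷ʳ (x ∷ xs) y

last⇒∷ʳ : ∀ {A : Set} (xs : List A) {y} → last xs ≡ just y → ∃ λ init → xs ≡ init ∷ʳ y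
last⇒∷ʳ (_ ∷ [])      refl = [] , refl
last⇒∷ʳ (x ∷ x' ∷ xs) eq with init , eq' ← last⇒∷ʳ (x' ∷ xs) eq = x ∷ init , cong (x ∷_) eq'

EndsBySnoc : ℕ → List Point → Set
EndsBySnoc n ps = ∃ λ init → (ps ≡ init ∷ʳ (n ∸ 1 , n)) ⊎ (ps ≡ init ∷ʳ (n , n ∸ 1))

endsBySnoc⇒endsAt : EndsBySnoc n ps → EndsAt n ps
endsBySnoc⇒endsAt (init , inj₁ refl) = inj₁ (last-∷ʳ init _)
endsBySnoc⇒endsAt (init , inj₂ refl) = inj₂ (last-∷ʳ init _)

endsAt⇒endsBySnoc : EndsAt n ps → EndsBySnoc n ps
endsAt⇒endsBySnoc {ps = ps} (inj₁ e) with init , eq ← last⇒∷ʳ ps e = init , inj₁ eq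
endsAt⇒endsBySnoc {ps = ps} (inj₂ e) with init , eq ← last⇒∷ʳ ps e = init , inj₂ eq

1<2 : 1 < 2
1<2 = s≤s (s≤s z≤n)

coherentPath⇒run : CoherentPath n ps → ∃ λ rest → ps ≡ (2 , 1) ∷ rest × Run n free true 1 2 rest
coherentPath⇒run cp with rest , refl ← LatticePath.starts (CoherentPath.isPath cp) =
  rest , refl ,
  tail⇒run free true (inGrid , steps , endsBySnoc⇒endsAt ends) coherent 1<2 (inj₁ (refl , refl))
  where open CoherentPath cp
        open LatticePath isPath

run⇒coherentPath : 2 ≤ n → Run n free true 1 2 rest → CoherentPath n ((2 , 1) ∷ rest)
run⇒coherentPath {rest = rest} 2≤n r with inGrid , steps , endsAt ← run-lattice r ≤-refl 1<2 2≤n = record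
  { isPath   = record
    { starts = rest , refl ; ends = endsAt⇒endsBySnoc endsAt ; inGrid = inGrid ; steps = steps }
  ; coherent = subst (AllPairs CoherentPair) (sym (enhancedSteps-run r 1<2)) (run-coherent r 1<2)
  }

opaque
  ℓmax-bound : ∀ L → 2 * L + 5 ≤ 3 * n → suc L ≤ ℓmax n
  ℓmax-bound {n = zero}  L le = ⊥-elim (<⇒≱ (s≤s z≤n) (m+n≤o⇒n≤o (2 * L) le))
  ℓmax-bound {n = suc m} L le = begin
    suc L          ≡⟨ sym (m*n/n≡m (suc L) 2) ⟩
    suc L * 2 / 2  ≤⟨ /-monoˡ-≤ 2 (+-cancelˡ-≤ 3 (suc L * 2) (3 * m) 3+[1+L]*2≤3+3m) ⟩
    3 * m / 2      ∎
    where
    open ≤-Reasoning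
    arith₁ : ∀ L → 2 * L + 5 ≡ 3 + suc L * 2
    arith₁ = solve-∀
    arith₂ : ∀ m → 3 * suc m ≡ 3 + 3 * m
    arith₂ = solve-∀
    3+[1+L]*2≤3+3m : 3 + suc L * 2 ≤ 3 + 3 * m
    3+[1+L]*2≤3+3m = subst₂ _≤_ (arith₁ L) (arith₂ m) le

  ℓmax-odd : ∀ k → ℓmax (3 + 2 * k) ≡ 3 + 3 * k
  ℓmax-odd k = trans (cong (_/ 2) (arith k)) (m*n/n≡m (3 + 3 * k) 2)
    where arith : ∀ k → 3 * (2 + 2 * k) ≡ (3 + 3 * k) * 2
          arith = solve-∀

  ℓmax-even : ∀ k → ℓmax (2 + 2 * k) ≡ 1 + 3 * k
  ℓmax-even k = begin
    3 * (1 + 2 * k) / 2      ≡⟨ cong (_/ 2) (arith k) ⟩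
    (1 + (1 + 3 * k) * 2) / 2  ≡⟨ +-distrib-/ 1 ((1 + 3 * k) * 2) remainders<2 ⟩
    (1 + 3 * k) * 2 / 2      ≡⟨ m*n/n≡m (1 + 3 * k) 2 ⟩
    1 + 3 * k                ∎
    where
    open ≡-Reasoning
    arith : ∀ k → 3 * (1 + 2 * k) ≡ 1 + (1 + 3 * k) * 2
    arith = solve-∀
    remainders<2 : 1 % 2 + (1 + 3 * k) * 2 % 2 < 2
    remainders<2 = subst (λ r → 1 + r < 2) (sym (m*n%n≡0 (1 + 3 * k) 2)) ≤-refl

  odd-%2 : ∀ k → (3 + 2 * k) % 2 ≡ 1
  odd-%2 k = trans (cong (_% 2) (arith k)) ([m+kn]%n≡m%n 1 (1 + k) 2)
    where arith : ∀ k → 3 + 2 * k ≡ 1 + (1 + k) * 2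
          arith = solve-∀

  even-%2 : ∀ k → (2 + 2 * k) % 2 ≡ 0
  even-%2 k = trans (cong (_% 2) (arith k)) (m*n%n≡0 (1 + k) 2)
    where arith : ∀ k → 2 + 2 * k ≡ (1 + k) * 2
          arith = solve-∀

  slack₀-of-length : ∀ k L → suc L ≡ ℓmax (3 + 2 * k) → 2 * L + 5 + 0 ≡ 3 * (3 + 2 * k)
  slack₀-of-length k L eq with refl ← suc-injective (trans eq (ℓmax-odd k)) = arith k
    where arith : ∀ k → 2 * (2 + 3 * k) + 5 + 0 ≡ 3 * (3 + 2 * k)
          arith = solve-∀

  slack₁-of-length : ∀ k L → suc L ≡ ℓmax (2 + 2 * k) → 2 * L + 5 + 1 ≡ 3 * (2 + 2 * k)
  slack₁-of-length k L eq with refl ← suc-injective (trans eq (ℓmax-even k)) = arith k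
    where arith : ∀ k → 2 * (3 * k) + 5 + 1 ≡ 3 * (2 + 2 * k)
          arith = solve-∀

coherentPath-length≤ℓmax : CoherentPath n ps → length ps ≤ ℓmax n
coherentPath-length≤ℓmax {n = n} cp with rest , refl , r ← coherentPath⇒run cp =
  ℓmax-bound {n = n} (length rest) (potential-bound r 1<2 tt)

MaximalPaths : ℕ → List (List Point) → Set
MaximalPaths n L = Unique L × ((ps : List Point) → (ps ∈ L) ⇔ (CoherentPath n ps × length ps ≡ ℓmax n))

maximal-odd : ∀ k → MaximalPaths (3 + 2 * k) (((2 , 1) ∷ tail₀-free true 1 k) ∷ [])
maximal-odd k = [] ∷ [] , λ _ → mk⇔ to from
  where
  size : ℕ
  size = 3 + 2 * k
  to : ps ∈ ((2 , 1) ∷ tail₀-free true 1 k) ∷ [] → CoherentPath size ps × length ps ≡ ℓmax size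
  to (here refl) = run⇒coherentPath (s≤s (s≤s z≤n)) (tail₀-free-run true 1 k refl)
                 , trans (cong suc (tail₀-free-length true 1 k)) (sym (ℓmax-odd k))
  from : CoherentPath size ps × length ps ≡ ℓmax size → ps ∈ ((2 , 1) ∷ tail₀-free true 1 k) ∷ []
  from (cp , len) with rest , refl , r ← coherentPath⇒run cp =
    here (cong ((2 , 1) ∷_) (slack₀-free k (r , slack₀-of-length k (length rest) len) refl))

maximal-even : ∀ k → MaximalPaths (2 + 2 * k) (map ((2 , 1) ∷_) (tails₁-free true 1 k))
maximal-even k = Unique.map⁺ ∷-injectiveʳ (tails₁-free-unique true 1 k) , λ _ → mk⇔ to from
  where
  size : ℕ
  size = 2 + 2 * k
  to : ps ∈ map ((2 , 1) ∷_) (tails₁-free true 1 k) → CoherentPath size ps × length ps ≡ ℓmax size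
  to m with _ , m' , refl ← ∈-map⁻ _ m =
    run⇒coherentPath (s≤s (s≤s z≤n)) (tails₁-free-run true 1 k m' refl)
    , trans (cong suc (tails₁-free-length true 1 k m')) (sym (ℓmax-even k))
  from : CoherentPath size ps × length ps ≡ ℓmax size → ps ∈ map ((2 , 1) ∷_) (tails₁-free true 1 k)
  from (cp , len) with rest , refl , r ← coherentPath⇒run cp =
    ∈-map⁺ _ (slack₁-free k (r , slack₁-of-length k (length rest) len) refl)

data SizeParity : ℕ → Set where
  odd  : ∀ k → SizeParity (3 + 2 * k)
  even : ∀ k → SizeParity (2 + 2 * k)

size-parity : 2 ≤ n → SizeParity n
size-parity {n = 1} (s≤s ())
size-parity {n = 2} _ = even 0
size-parity {n = 3} _ = odd 0
size-parity {n = suc (suc (suc (suc m)))} _ with size-parity {n = 2 + m} (s≤s (s≤s z≤n))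
... | odd k  = subst SizeParity (cong (3 +_) (*-suc 2 k)) (odd (suc k))
... | even k = subst SizeParity (cong (2 +_) (*-suc 2 k)) (even (suc k))

∈-of-length≡suc : ∀ {A : Set} (xs : List A) {m} → length xs ≡ suc m → ∃ λ x → x ∈ xs
∈-of-length≡suc (x ∷ _) _ = x , here refl

maximal-paths : SizeParity n → Σ (List (List Point)) λ L →
  MaximalPaths n L × (∃ λ ps → ps ∈ L) × (n % 2 ≡ 1 → length L ≡ 1) × (n % 2 ≡ 0 → length L ≡ ℓmax n)
maximal-paths (odd k) =
  _ , maximal-odd k , (_ , here refl) , (λ _ → refl) ,
  λ n%2≡0 → ⊥-elim (0≢1+n (trans (sym n%2≡0) (odd-%2 k)))
maximal-paths (even k) =
  L , maximal-even k , ∈-of-length≡suc L count ,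
  (λ n%2≡1 → ⊥-elim (0≢1+n (trans (sym (even-%2 k)) n%2≡1))) ,
  λ _ → trans count (sym (ℓmax-even k))
  where L : List (List Point)
        L = map ((2 , 1) ∷_) (tails₁-free true 1 k)
        count : length L ≡ 1 + 3 * k
        count = trans (length-map _ (tails₁-free true 1 k)) (tails₁-free-count true 1 k)

theorem5p6 : (n : ℕ) → 4 ≤ n →
    ((ps : List Point) → CoherentPath n ps → length ps ≤ ℓmax n)
    × (∃ λ ps → CoherentPath n ps × length ps ≡ ℓmax n)
    × (Σ (List (List Point)) λ L →
         Unique L
         × ((ps : List Point) → (ps ∈ L) ⇔ (CoherentPath n ps × length ps ≡ ℓmax n))
         × (n % 2 ≡ 1 → length L ≡ 1)
         × (n % 2 ≡ 0 → length L ≡ ℓmax n))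
theorem5p6 n 4≤n
  with L , (unique , members) , (ps , ps∈L) , odd-count , even-count
         ← maximal-paths (size-parity (≤-trans (s≤s (s≤s z≤n)) 4≤n))
  = (λ _ → coherentPath-length≤ℓmax)
  , (ps , Equivalence.to (members ps) ps∈L)
  , L , unique , members , odd-count , even-count
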